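{- If $\alpha_1,\alpha_2,\dots,\alpha_s$ ($s\ge 1$) are super-basic sequences, then there exists a finite sequence $\zeta$ of positive integers such that the concatenation $\alpha_1\alpha_2\cdots\alpha_s\zeta$ is a quiddity sequence.
   Context: A basic sequence is a finite sequence of integers $(1,A_1,\dots,A_n)$ with $n\ge 1$ and $A_1,\dots,A_n\ge 2$; it is super-basic if moreover $n>1$, $A_1>2$ and $A_n>2$. Quiddity sequences (equivalently $\eta$-sequences) are finite sequences of positive integers of length $\ge 3$ defined recursively: (1) $(1,1,1)$ is a quiddity sequence; (2) if $(c_0,c_1,\dots,c_{n-1})$ is a quiddity sequence then so is $(c_1,\dots,c_{n-1},c_0)$; (3) if $(c_0,c_1,c_2,\dots,c_{n-1})$ is a quiddity sequence then so is $(c_0+1,1,c_1+1,c_2,\dots,c_{n-1})$; only sequences obtained this way are quiddity sequences. -}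

module Defs where

open import Data.Nat using (ℕ; suc; _≤_; _<_; _>_; _≥_)
open import Data.List using (List; []; _∷_; _++_; length; concat; last)
open import Data.List.Relation.Unary.All using (All)
open import Data.Maybe using (just)
open import Data.Product using (Σ; _×_; ∃)
open import Relation.Binary.PropositionalEquality using (_≡_)

record Basic (xs : List ℕ) : Set where
  constructor basic
  field
    tail      : List ℕ
    shape     : xs ≡ 1 ∷ tail
    nonempty  : 1 ≤ length tail
    allGe2    : All (λ a → 2 ≤ a) tail

record SuperBasic (xs : List ℕ) : Set where
  constructor superBasic
  field
    A₁    : ℕ
    rest  : List ℕ
    Aₙ    : ℕ
    shape     : xs ≡ 1 ∷ A₁ ∷ rest
    isBasic   : Basic xs
    longEnough : 1 < length (A₁ ∷ rest)
    lastIs    : last (A₁ ∷ rest) ≡ just Aₙ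
    A₁>2      : A₁ > 2
    Aₙ>2      : Aₙ > 2

data Quiddity : List ℕ → Set where
  base   : Quiddity (1 ∷ 1 ∷ 1 ∷ [])
  rotate : ∀ {c₀ cs} → Quiddity (c₀ ∷ cs) → Quiddity (cs ++ (c₀ ∷ []))
  insert : ∀ {c₀ c₁ c₂ cs} → Quiddity (c₀ ∷ c₁ ∷ c₂ ∷ cs) →
           Quiddity (suc c₀ ∷ 1 ∷ suc c₁ ∷ c₂ ∷ cs)

module Submission where

-- Quiddity sequences are closed under all cyclic rotations, so
-- the insertion rule  (c₀, c₁, …) ↦ (c₀+1, 1, c₁+1, …)  may be applied at any
-- position.  Applying it repeatedly at one position raises an entry v to any
-- t > v while leaving a 1 right after it ("raising"); a raise by at least two
-- even leaves  t, 1, 2  behind.  A super-basic sequence  1, A₁, …, Aₙ  is then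
-- written from left to right: raise the entry 2 following the leading 1 up to
-- A₁ > 2, raise each following 1 to the middle entries Aᵢ ≥ 2, and finally
-- raise the last 1 to Aₙ > 2 by at least two.  This turns a quiddity sequence
-- of the form  q, 1, 2, …  into one of the form  q, α, 1, 2, …, so the shape
-- "prefix followed by 1, 2" is an invariant that lets the blocks be written
-- one after the other, starting from the quiddity sequence (1, 2, 1, 2).

open import Defs
open import Data.Nat using (ℕ; suc; _<_; _≤_; z≤n; s≤s; _≤′_; ≤′-refl; ≤′-step)
open import Data.Nat.Properties using (≤⇒≤′)
open import Data.List using (List; []; _∷_; _++_; _∷ʳ_; concat; length; last)
open import Data.List.Properties using (++-assoc; ++-identityʳ; length-++-comm)
open import Data.List.Relation.Unary.All using (All; []; _∷_)
open import Data.List.Relation.Unary.All.Properties using (++⁺; ++⁻ʳ)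
open import Data.Maybe using (just)
open import Data.Product using (Σ; _×_; _,_; ∃₂)
open import Relation.Binary.PropositionalEquality
  using (_≡_; refl; sym; cong; subst; module ≡-Reasoning)

quiddity-length : ∀ {cs} → Quiddity cs → 3 ≤ length cs
quiddity-length base = s≤s (s≤s (s≤s z≤n))
quiddity-length (rotate {c₀} {cs} q) =
  subst (3 ≤_) (sym (length-++-comm cs (c₀ ∷ []))) (quiddity-length q)
quiddity-length (insert q) = s≤s (s≤s (s≤s z≤n))

quiddity-positive : ∀ {cs} → Quiddity cs → All (0 <_) cs
quiddity-positive base = s≤s z≤n ∷ s≤s z≤n ∷ s≤s z≤n ∷ []
quiddity-positive (rotate q) with quiddity-positive q
... | p ∷ ps = ++⁺ ps (p ∷ [])
quiddity-positive (insert q) with quiddity-positive q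
... | _ ∷ _ ∷ p ∷ ps = s≤s z≤n ∷ s≤s z≤n ∷ s≤s z≤n ∷ p ∷ ps

rotate-by : ∀ xs ys → Quiddity (xs ++ ys) → Quiddity (ys ++ xs)
rotate-by [] ys q = subst Quiddity (sym (++-identityʳ ys)) q
rotate-by (x ∷ xs) ys q =
  subst Quiddity (++-assoc ys (x ∷ []) xs)
    (rotate-by xs (ys ++ x ∷ []) (subst Quiddity (++-assoc xs ys (x ∷ [])) (rotate q)))

-- The insertion rule at the front needs no third entry to be named:
-- a quiddity sequence never has only two entries.
insert-front : ∀ {v x ys} → Quiddity (v ∷ x ∷ ys) → Quiddity (suc v ∷ 1 ∷ suc x ∷ ys)
insert-front {ys = []} q with quiddity-length q
... | s≤s (s≤s ())
insert-front {ys = _ ∷ _} q = insert q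

insert-at : ∀ p {v x r} → Quiddity (p ++ v ∷ x ∷ r) → Quiddity (p ++ suc v ∷ 1 ∷ suc x ∷ r)
insert-at p {v} {x} {r} q =
  rotate-by (suc v ∷ 1 ∷ suc x ∷ r) p (insert-front (rotate-by p (v ∷ x ∷ r) q))

-- Raising: an entry v can be increased to any t > v, leaving a 1 behind it.
-- Each insertion at the pair (t, 1) gives (t + 1, 1, 2), hence the induction.
raise : ∀ p {v x r t} → v < t → Quiddity (p ++ v ∷ x ∷ r) →
        ∃₂ λ x′ r′ → Quiddity (p ++ t ∷ 1 ∷ x′ ∷ r′)
raise p {v} {x} {r} v<t q = go (≤⇒≤′ v<t)
  where
  go : ∀ {t} → suc v ≤′ t → ∃₂ λ x′ r′ → Quiddity (p ++ t ∷ 1 ∷ x′ ∷ r′)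
  go ≤′-refl = suc x , r , insert-at p q
  go (≤′-step v<t) with go v<t
  ... | x′ , r′ , q′ = 2 , x′ ∷ r′ , insert-at p q′

raise₂ : ∀ p {v x r t} → suc v < t → Quiddity (p ++ v ∷ x ∷ r) →
         ∃₂ λ y r′ → Quiddity (p ++ t ∷ 1 ∷ 2 ∷ y ∷ r′)
raise₂ p {t = suc t} (s≤s v+1≤t) q with raise p v+1≤t q
... | x′ , r′ , q′ = x′ , r′ , insert-at p q′

regroup : ∀ p xs {s} → Quiddity (p ++ xs ++ s) → Quiddity ((p ++ xs) ++ s)
regroup p xs {s} = subst Quiddity (sym (++-assoc p xs s))

-- Entries ≥ 2 can be written one by one in place of a 1, each raise
-- leaving a new 1 behind for the next entry.
fill : ∀ p {ms x r} → All (2 ≤_) ms → Quiddity (p ++ 1 ∷ x ∷ r) →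
       ∃₂ λ x′ r′ → Quiddity (p ++ ms ++ 1 ∷ x′ ∷ r′)
fill p [] q = _ , _ , q
fill p {m ∷ ms} (m≥2 ∷ ms≥2) q with raise p m≥2 q
... | x′ , r′ , q′ with fill (p ++ m ∷ []) ms≥2 (regroup p (m ∷ []) q′)
... | x″ , r″ , q″ = x″ , r″ , subst Quiddity (++-assoc p (m ∷ []) _) q″

Extendable : List ℕ → Set
Extendable q = ∃₂ λ y r → Quiddity (q ++ 1 ∷ 2 ∷ y ∷ r)

extendable-[] : Extendable []
extendable-[] = 1 , 2 ∷ [] , rotate (insert base)

write-block : ∀ q {a ms b} → 2 < a → All (2 ≤_) ms → 2 < b →
              Extendable q → Extendable (q ++ 1 ∷ a ∷ ms ∷ʳ b)
write-block q {a} {ms} {b} a>2 ms≥2 b>2 (_ , _ , q₀)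
  with raise (q ++ 1 ∷ []) a>2 (regroup q (1 ∷ []) q₀)
... | _ , _ , q₁
  with fill ((q ++ 1 ∷ []) ++ a ∷ []) ms≥2 (regroup (q ++ 1 ∷ []) (a ∷ []) q₁)
... | _ , _ , q₂
  with raise₂ (((q ++ 1 ∷ []) ++ a ∷ []) ++ ms) b>2 (regroup ((q ++ 1 ∷ []) ++ a ∷ []) ms q₂)
... | y′ , r′ , q₃ = y′ , r′ , subst Quiddity reassociate q₃
  where
  open ≡-Reasoning
  s : List ℕ
  s = 1 ∷ 2 ∷ y′ ∷ r′
  reassociate : (((q ++ 1 ∷ []) ++ a ∷ []) ++ ms) ++ b ∷ s ≡ (q ++ 1 ∷ a ∷ ms ∷ʳ b) ++ s
  reassociate = begin
    (((q ++ 1 ∷ []) ++ a ∷ []) ++ ms) ++ b ∷ s ≡⟨ ++-assoc _ ms (b ∷ s) ⟩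
    ((q ++ 1 ∷ []) ++ a ∷ []) ++ ms ++ b ∷ s   ≡⟨ ++-assoc _ (a ∷ []) _ ⟩
    (q ++ 1 ∷ []) ++ a ∷ ms ++ b ∷ s           ≡⟨ ++-assoc q (1 ∷ []) _ ⟩
    q ++ 1 ∷ a ∷ ms ++ b ∷ s
      ≡⟨ cong (λ t → q ++ 1 ∷ a ∷ t) (sym (++-assoc ms (b ∷ []) s)) ⟩
    q ++ 1 ∷ a ∷ (ms ∷ʳ b) ++ s                ≡⟨ sym (++-assoc q (1 ∷ a ∷ ms ∷ʳ b) s) ⟩
    (q ++ 1 ∷ a ∷ ms ∷ʳ b) ++ s                ∎

split-last : ∀ {P : ℕ → Set} u us {a} → last (u ∷ us) ≡ just a → All P (u ∷ us) →
             Σ (List ℕ) λ ms → u ∷ us ≡ ms ∷ʳ a × All P ms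
split-last u [] refl (_ ∷ []) = [] , refl , []
split-last u (v ∷ vs) last≡a (pu ∷ pvs) with split-last v vs last≡a pvs
... | ms , v∷vs≡ms∷ʳa , pms = u ∷ ms , cong (u ∷_) v∷vs≡ms∷ʳa , pu ∷ pms

extend : ∀ q {α} → SuperBasic α → Extendable q → Extendable (q ++ α)
extend q (superBasic _ [] _ refl _ (s≤s ()) _ _ _)
extend q (superBasic _ (u ∷ us) _ refl (basic _ refl _ (_ ∷ entries≥2))
                    _ last≡Aₙ A₁>2 Aₙ>2) e
  with split-last u us last≡Aₙ entries≥2
... | ms , u∷us≡ms∷ʳAₙ , ms≥2 rewrite u∷us≡ms∷ʳAₙ =
  write-block q A₁>2 ms≥2 Aₙ>2 e

extend-all : ∀ q {αs} → All SuperBasic αs → Extendable q → Extendable (q ++ concat αs)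
extend-all q [] e = subst Extendable (sym (++-identityʳ q)) e
extend-all q {α ∷ αs} (sb ∷ sbs) e =
  subst Extendable (++-assoc q α (concat αs)) (extend-all (q ++ α) sbs (extend q sb e))

proposition3 : (αs : List (List ℕ)) → 1 ≤ length αs →
    All SuperBasic αs →
    Σ (List ℕ) (λ ζ → All (λ z → 0 < z) ζ × Quiddity (concat αs ++ ζ))
proposition3 αs _ superBasics with extend-all [] superBasics extendable-[]
... | y , r , quiddity =
  1 ∷ 2 ∷ y ∷ r , ++⁻ʳ (concat αs) (quiddity-positive quiddity) , quiddity
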